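{- Define three classes of frames: - $\mathcal{C}_{\mathbf{ud}}$ is the class of all frames that are up and down reflexive and up and down symmetric; - $\mathcal{C}_{\mathbf{rs}}$ is the class of all frames in which every $R(\alpha)$ is reflexive and symmetric; - $\mathcal{C}_{\mathbf{par}}$ is the class of all frames in which every $R(\alpha)$ is reflexive, symmetric and transitive. Then $\mathtt{Log}(\mathcal{C}_{\mathbf{ud}})=\mathtt{Log}(\mathcal{C}_{\mathbf{rs}})=\mathtt{Log}(\mathcal{C}_{\mathbf{par}})$. Here a frame is up and down reflexive if for every group $\alpha$ and every $s$, $s\,(\leq\circ R(\alpha)\circ\leq)\,s$ and $s\,(\geq\circ R(\alpha)\circ\geq)\,s$. It is up and down symmetric if for every group $\alpha$ and all $s,t$, $sR(\alpha)t$ implies $t\,(\leq\circ R(\alpha)\circ\leq)\,s$ and $t\,(\geq\circ R(\alpha)\circ\geq)\,s$.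
   Context: **Language.** Let $\mathbf{At}$ be a countably infinite set of atoms and let $\mathbf{Ag}$ be a finite set of agents. A group is a nonempty subset of $\mathbf{Ag}$. Formulas are generated by $$A ::= p \mid (A\rightarrow A) \mid \top \mid \bot \mid (A\vee A) \mid (A\wedge A) \mid [\alpha]A \mid \langle\alpha\rangle A.$$ **Frames.** A frame is a triple $(W,\leq,R)$ where $W$ is a nonempty set, $\leq$ is a preorder on $W$, and $R$ assigns to each group $\alpha$ a binary relation $R(\alpha)$ on $W$. For binary relations $S,T$, write $s\,(S\circ T)\,t$ iff there is $u$ with $sSu$ and $uTt$. Write $\geq$ for the converse of $\leq$. **Models and satisfaction.** A valuation is a map $V:\mathbf{At}\to\wp(W)$ with each $V(p)$ upward closed under $\leq$. Satisfaction in a model $(W,\leq,R,V)$ is defined as follows: - $s\models p$ iff $s\in V(p)$; - $s\models A\rightarrow B$ iff for all $t\geq s$, either $t\not\models A$ or $t\models B$; - $s\models\top$, and $s\not\models\bot$; - $\vee$ and $\wedge$ are interpreted pointwise; - $s\models[\alpha]A$ iff for all $t$ with $s\,(\leq\circ R(\alpha))\,t$, $t\models A$; - $s\models\langle\alpha\rangle A$ iff there is $t$ with $s\,(\geq\circ R(\alpha))\,t$ and $t\models A$. A formula is valid in a frame if it is satisfied at every state of every model based on that frame. For a class $\mathcal{C}$ of frames, $\mathtt{Log}(\mathcal{C})$ is the set of formulas valid in every frame in $\mathcal{C}$. -}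

module Defs where

open import Level using (Level; _⊔_) renaming (suc to lsuc)
open import Data.Nat using (ℕ)
open import Data.Fin.Subset using (Subset; Nonempty)
open import Data.Product using (Σ; ∃; _×_; _,_)
open import Data.Sum using (_⊎_)
open import Data.Unit.Polymorphic using (⊤)
open import Data.Empty.Polymorphic using (⊥)
open import Relation.Binary using (Rel; IsPreorder; Reflexive; Symmetric; Transitive)
open import Relation.Binary.PropositionalEquality using (_≡_)
open import Relation.Nullary using (¬_)
open import Function.Bundles using (_⇔_)

Atom : Set
Atom = ℕ

Group : ℕ → Set
Group n = Σ (Subset n) Nonempty

data Form (n : ℕ) : Set where
  atom : Atom → Form n
  _⇒_  : Form n → Form n → Form n
  ⊤f   : Form n
  ⊥f   : Form n
  _∨f_ : Form n → Form n → Form n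
  _∧f_ : Form n → Form n → Form n
  box  : Group n → Form n → Form n
  dia  : Group n → Form n → Form n

_⨾_ : ∀ {ℓ} {W : Set ℓ} → Rel W ℓ → Rel W ℓ → Rel W ℓ
(S ⨾ T) s t = ∃ λ u → S s u × T u t

conv : ∀ {ℓ} {W : Set ℓ} → Rel W ℓ → Rel W ℓ
conv S s t = S t s

record Frame (n : ℕ) (ℓ : Level) : Set (lsuc ℓ) where
  field
    W      : Set ℓ
    w₀     : W                       -- W is nonempty
    _≤_    : Rel W ℓ
    isPre  : IsPreorder _≡_ _≤_
    R      : Group n → Rel W ℓ

  _≥_ : Rel W ℓ
  _≥_ = conv _≤_

record Valuation {n ℓ} (F : Frame n ℓ) : Set (lsuc ℓ) where
  open Frame F
  field
    V      : Atom → W → Set ℓ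
    upward : ∀ p {s t} → s ≤ t → V p s → V p t

module _ {n ℓ} (F : Frame n ℓ) (Val : Valuation F) where
  open Frame F
  open Valuation Val

  _⊨_ : W → Form n → Set ℓ
  s ⊨ atom p  = V p s
  s ⊨ (A ⇒ B) = ∀ t → s ≤ t → t ⊨ A → t ⊨ B
  s ⊨ ⊤f      = ⊤
  s ⊨ ⊥f      = ⊥
  s ⊨ (A ∨f B) = (s ⊨ A) ⊎ (s ⊨ B)
  s ⊨ (A ∧f B) = (s ⊨ A) × (s ⊨ B)
  s ⊨ box α A = ∀ t → (_≤_ ⨾ R α) s t → t ⊨ A
  s ⊨ dia α A = ∃ λ t → (_≥_ ⨾ R α) s t × (t ⊨ A)

ValidIn : ∀ {n ℓ} → Form n → Frame n ℓ → Set (lsuc ℓ)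
ValidIn A F = ∀ (Val : Valuation F) (s : Frame.W F) → _⊨_ F Val s A

FrameClass : ℕ → (ℓ : Level) → Set (lsuc ℓ)
FrameClass n ℓ = Frame n ℓ → Set ℓ

Log : ∀ {n ℓ} → FrameClass n ℓ → Form n → Set (lsuc ℓ)
Log C A = ∀ F → C F → ValidIn A F

module _ {n ℓ} (F : Frame n ℓ) where
  open Frame F

  UpDownReflexive : Set ℓ
  UpDownReflexive = ∀ α s → ((_≤_ ⨾ R α) ⨾ _≤_) s s × ((_≥_ ⨾ R α) ⨾ _≥_) s s

  UpDownSymmetric : Set ℓ
  UpDownSymmetric = ∀ α s t → R α s t → ((_≤_ ⨾ R α) ⨾ _≤_) t s × ((_≥_ ⨾ R α) ⨾ _≥_) t s

  AllReflSym : Set ℓ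
  AllReflSym = ∀ α → Reflexive (R α) × Symmetric (R α)

  AllEquiv : Set ℓ
  AllEquiv = ∀ α → Reflexive (R α) × Symmetric (R α) × Transitive (R α)

C-ud : ∀ {n ℓ} → FrameClass n ℓ
C-ud F = (UpDownReflexive F × UpDownSymmetric F)

C-rs : ∀ {n ℓ} → FrameClass n ℓ
C-rs F = (AllReflSym F)

C-par : ∀ {n ℓ} → FrameClass n ℓ
C-par F = (AllEquiv F)

-- Each class contains the next (reflexive relations are up and down reflexive, and so on), so
-- Log C-ud ⊆ Log C-rs ⊆ Log C-par.  For the converses every frame of the larger class is
-- covered by a frame of the smaller one: a surjection onto it that pulls back the preorder,
-- lifts R-steps, and sends R-steps into ≤∘R∘≤ and ≥∘R∘≥.  Covers reflect truth under the
-- pulled-back valuation, hence validity.  An up and down reflexive and symmetric frame is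
-- covered (along the identity) by the reflexive symmetric closure of its relations.  A
-- reflexive symmetric frame is covered by pairs (s , f) with f choosing an α-neighbour f α
-- for each group: (s , f) and (t , g) are α-related iff they are equal at α or are the two
-- ends s R t of the same edge; these relations are equivalences.
module Submission where

open import Defs
open import Level using (Level)
open import Data.Nat using (ℕ)
open import Data.Product using (Σ; ∃; _×_; _,_; proj₁; proj₂)
open import Data.Sum using (_⊎_; inj₁; inj₂)
open import Data.Unit.Polymorphic using (tt)
open import Function.Base using (id)
open import Function.Bundles using (_⇔_; mk⇔)
open import Relation.Binary using (Rel; IsPreorder)
open import Relation.Binary.PropositionalEquality
  using (_≡_; refl; sym; trans; cong; subst; isEquivalence)
open import Relation.Binary.Construct.Closure.Reflexive using (ReflClosure; refl; [_])
import Relation.Binary.Construct.Closure.Reflexive.Properties as ReflClosureProperties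
open import Relation.Binary.Construct.Closure.Symmetric as SymClosure using (SymClosure; fwd; bwd)

module _ {n ℓ} (F : Frame n ℓ) where
  open Frame F

  Up Down : Group n → Rel W ℓ
  Up α   = (_≤_ ⨾ R α) ⨾ _≤_
  Down α = (_≥_ ⨾ R α) ⨾ _≥_

module FrameProperties {n ℓ} (F : Frame n ℓ) where
  open Frame F
  open IsPreorder isPre using () renaming (refl to ≤-refl; trans to ≤-trans)

  R⇒Up×Down : ∀ {α s t} → R α s t → Up F α s t × Down F α s t
  R⇒Up×Down {s = s} {t} r = (t , (s , ≤-refl , r) , ≤-refl) , (t , (s , ≤-refl , r) , ≤-refl)

  ⊨-persistent : (Val : Valuation F) → ∀ A {s t} → s ≤ t → _⊨_ F Val s A → _⊨_ F Val t A
  ⊨-persistent Val (atom p) s≤t h = Valuation.upward Val p s≤t h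
  ⊨-persistent Val (A ⇒ B) s≤t h u t≤u = h u (≤-trans s≤t t≤u)
  ⊨-persistent Val ⊤f s≤t h = tt
  ⊨-persistent Val (A ∨f B) s≤t (inj₁ a) = inj₁ (⊨-persistent Val A s≤t a)
  ⊨-persistent Val (A ∨f B) s≤t (inj₂ b) = inj₂ (⊨-persistent Val B s≤t b)
  ⊨-persistent Val (A ∧f B) s≤t (a , b) = ⊨-persistent Val A s≤t a , ⊨-persistent Val B s≤t b
  ⊨-persistent Val (box α A) s≤t h u (v , t≤v , r) = h u (v , ≤-trans s≤t t≤v , r)
  ⊨-persistent Val (dia α A) s≤t (u , (v , v≤s , r) , hu) = u , (v , ≤-trans v≤s s≤t , r) , hu

C-par⊆C-rs : ∀ {n ℓ} (F : Frame n ℓ) → C-par F → C-rs F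
C-par⊆C-rs F par α = proj₁ (par α) , proj₁ (proj₂ (par α))

C-rs⊆C-ud : ∀ {n ℓ} (F : Frame n ℓ) → C-rs F → C-ud F
C-rs⊆C-ud F rs = (λ α s → R⇒Up×Down (proj₁ (rs α)))
               , (λ α s t r → R⇒Up×Down (proj₂ (rs α) r))
  where open FrameProperties F

Log-antitone : ∀ {n ℓ} {C D : FrameClass n ℓ} → (∀ F → C F → D F) → ∀ A → Log D A → Log C A
Log-antitone C⊆D A valid F CF = valid F (C⊆D F CF)

record Cover {n ℓ} (G F : Frame n ℓ) : Set ℓ where
  private
    module G = Frame G
    module F = Frame F
  field
    π          : G.W → F.W
    surjective : ∀ s → ∃ λ x → π x ≡ s
    π-mono     : ∀ {x y} → x G.≤ y → π x F.≤ π y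
    π-reflects : ∀ {x y} → π x F.≤ π y → x G.≤ y
    R-lift     : ∀ {α s t} → F.R α s t → ∃ λ x → ∃ λ y → π x ≡ s × π y ≡ t × G.R α x y
    R-forth    : ∀ {α x y} → G.R α x y → Up F α (π x) (π y) × Down F α (π x) (π y)

module CoverTruth {n ℓ} {G F : Frame n ℓ} (cover : Cover G F) (Val : Valuation F) where
  open Cover cover
  open Frame F using (_≤_)
  open IsPreorder (Frame.isPre F) using () renaming (trans to ≤-trans)
  open FrameProperties F using (⊨-persistent)

  pullback : Valuation G
  pullback = record { V = λ p x → Valuation.V Val p (π x)
                    ; upward = λ p x≤y → Valuation.upward Val p (π-mono x≤y) }

  _⊨G_ : Frame.W G → Form n → Set ℓ
  _⊨G_ = _⊨_ G pullback

  _⊨F_ : Frame.W F → Form n → Set ℓ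
  _⊨F_ = _⊨_ F Val

  project-⊨ : ∀ A x → x ⊨G A → π x ⊨F A
  lift-⊨    : ∀ A x → π x ⊨F A → x ⊨G A

  project-⊨ (atom p) x h = h
  project-⊨ (A ⇒ B) x h t πx≤t a with surjective t
  ... | y , refl = project-⊨ B y (h y (π-reflects πx≤t) (lift-⊨ A y a))
  project-⊨ ⊤f x h = tt
  project-⊨ (A ∨f B) x (inj₁ a) = inj₁ (project-⊨ A x a)
  project-⊨ (A ∨f B) x (inj₂ b) = inj₂ (project-⊨ B x b)
  project-⊨ (A ∧f B) x (a , b) = project-⊨ A x a , project-⊨ B x b
  project-⊨ (box α A) x h t (u , πx≤u , r) with R-lift r
  ... | u' , t' , refl , refl , r' = project-⊨ A t' (h t' (u' , π-reflects πx≤u , r'))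
  project-⊨ (dia α A) x (y , (u , u≤x , r') , hy) with proj₂ (R-forth r')
  ... | t , (v , v≤πu , r) , πy≤t =
    t , (v , ≤-trans v≤πu (π-mono u≤x) , r) , ⊨-persistent Val A πy≤t (project-⊨ A y hy)

  lift-⊨ (atom p) x h = h
  lift-⊨ (A ⇒ B) x h y x≤y a = lift-⊨ B y (h (π y) (π-mono x≤y) (project-⊨ A y a))
  lift-⊨ ⊤f x h = tt
  lift-⊨ (A ∨f B) x (inj₁ a) = inj₁ (lift-⊨ A x a)
  lift-⊨ (A ∨f B) x (inj₂ b) = inj₂ (lift-⊨ B x b)
  lift-⊨ (A ∧f B) x (a , b) = lift-⊨ A x a , lift-⊨ B x b
  lift-⊨ (box α A) x h y (u , x≤u , r') with proj₁ (R-forth r')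
  ... | t , (v , πu≤v , r) , t≤πy =
    lift-⊨ A y (⊨-persistent Val A t≤πy (h t (v , ≤-trans (π-mono x≤u) πu≤v , r)))
  lift-⊨ (dia α A) x (t , (u , u≤πx , r) , ht) with R-lift r
  ... | u' , t' , refl , refl , r' = t' , (u' , π-reflects u≤πx , r') , lift-⊨ A t' ht

Cover-reflects-validity : ∀ {n ℓ} {G F : Frame n ℓ} → Cover G F → ∀ A → ValidIn A G → ValidIn A F
Cover-reflects-validity cover A valid Val s with Cover.surjective cover s
... | x , refl = project-⊨ A x (valid pullback x)
  where open CoverTruth cover Val

Log-reflect : ∀ {n ℓ} {C D : FrameClass n ℓ} → (∀ F → C F → Σ (Frame n ℓ) λ G → D G × Cover G F) →
              ∀ A → Log D A → Log C A
Log-reflect covered A valid F CF with covered F CF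
... | G , DG , cover = Cover-reflects-validity cover A (valid G DG)

module ReflSymClosure {n ℓ} (F : Frame n ℓ) (ud : C-ud F) where
  open Frame F

  closure : Frame n ℓ
  closure = record { W = W ; w₀ = w₀ ; _≤_ = _≤_ ; isPre = isPre
                   ; R = λ α → ReflClosure (SymClosure (R α)) }

  closure-rs : C-rs closure
  closure-rs α = refl , ReflClosureProperties.sym (SymClosure.symmetric (R α))

  closure-covers : Cover closure F
  closure-covers = record
    { π = id ; surjective = λ s → s , refl ; π-mono = id ; π-reflects = id
    ; R-lift = λ {_} {s} {t} r → s , t , refl , refl , [ fwd r ]
    ; R-forth = forth }
    where
      forth : ∀ {α s t} → ReflClosure (SymClosure (R α)) s t → Up F α s t × Down F α s t
      forth {α} {s} refl = proj₁ ud α s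
      forth [ fwd r ]    = FrameProperties.R⇒Up×Down F r
      forth {α} {s} {t} [ bwd r ] = proj₂ ud α t s r

module EdgeUnfolding {n ℓ} (F : Frame n ℓ) (rs : C-rs F) where
  open Frame F
  open IsPreorder isPre using () renaming (reflexive to ≤-reflexive; trans to ≤-trans)

  Point : Set ℓ
  Point = W × (Group n → W)

  Paired : Group n → Rel Point ℓ
  Paired α (s , f) (t , g) = (s ≡ t × f α ≡ g α) ⊎ (s ≡ g α × f α ≡ t × R α s t)

  Paired⇒R : ∀ {α x y} → Paired α x y → R α (proj₁ x) (proj₁ y)
  Paired⇒R {α} {x} (inj₁ (s≡t , _)) = subst (R α (proj₁ x)) s≡t (proj₁ (rs α))
  Paired⇒R (inj₂ (_ , _ , r)) = r

  unfolded : Frame n ℓ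
  unfolded = record
    { W = Point ; w₀ = w₀ , (λ _ → w₀) ; _≤_ = λ x y → proj₁ x ≤ proj₁ y
    ; isPre = record { isEquivalence = isEquivalence
                     ; reflexive = λ x≡y → ≤-reflexive (cong proj₁ x≡y)
                     ; trans = ≤-trans }
    ; R = Paired }

  unfolded-par : C-par unfolded
  unfolded-par α = inj₁ (refl , refl) , (λ {x y} → Paired-sym {x} {y})
                  , (λ {x y z} → Paired-trans {x} {y} {z})
    where
      Paired-sym : ∀ {x y} → Paired α x y → Paired α y x
      Paired-sym (inj₁ (e₁ , e₂)) = inj₁ (sym e₁ , sym e₂)
      Paired-sym (inj₂ (e₁ , e₂ , r)) = inj₂ (sym e₂ , sym e₁ , proj₂ (rs α) r)

      Paired-trans : ∀ {x y z} → Paired α x y → Paired α y z → Paired α x z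
      Paired-trans (inj₁ (a₁ , a₂)) (inj₁ (b₁ , b₂)) = inj₁ (trans a₁ b₁ , trans a₂ b₂)
      Paired-trans (inj₁ (a₁ , a₂)) (inj₂ (b₁ , b₂ , r)) =
        inj₂ (trans a₁ b₁ , trans a₂ b₂ , subst (λ w → R α w _) (sym a₁) r)
      Paired-trans {x} (inj₂ (a₁ , a₂ , r)) (inj₁ (b₁ , b₂)) =
        inj₂ (trans a₁ b₂ , trans a₂ b₁ , subst (R α (proj₁ x)) b₁ r)
      Paired-trans (inj₂ (a₁ , a₂ , _)) (inj₂ (b₁ , b₂ , _)) = inj₁ (trans a₁ b₂ , trans a₂ b₁)

  unfolded-covers : Cover unfolded F
  unfolded-covers = record
    { π = proj₁ ; surjective = λ s → (s , λ _ → s) , refl ; π-mono = id ; π-reflects = id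
    ; R-lift = λ {_} {s} {t} r → (s , λ _ → t) , (t , λ _ → s) , refl , refl , inj₂ (refl , refl , r)
    ; R-forth = λ {α} {x} {y} p → FrameProperties.R⇒Up×Down F (Paired⇒R {α} {x} {y} p) }

proposition17 : (n : ℕ) (ℓ : Level) (A : Form n) →
    (Log {n} {ℓ} C-ud A ⇔ Log {n} {ℓ} C-rs A) × (Log {n} {ℓ} C-rs A ⇔ Log {n} {ℓ} C-par A)
proposition17 n ℓ A =
    mk⇔ (Log-antitone C-rs⊆C-ud A) (Log-reflect ud-covered A)
  , mk⇔ (Log-antitone C-par⊆C-rs A) (Log-reflect rs-covered A)
  where
    ud-covered : ∀ F → C-ud F → Σ (Frame n ℓ) λ G → C-rs G × Cover G F
    ud-covered F ud = closure , closure-rs , closure-covers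
      where open ReflSymClosure F ud

    rs-covered : ∀ F → C-rs F → Σ (Frame n ℓ) λ G → C-par G × Cover G F
    rs-covered F rs = unfolded , unfolded-par , unfolded-covers
      where open EdgeUnfolding F rs
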